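{- Let $m>n$ be positive integers and let $G[V_1,V_2]$ be a balanced bipartite graph with $|V_1|=|V_2|=m+n-1$ and minimum degree $\delta(G)>\frac{3}{4}(m+n-1)$. Suppose a red-blue-edge-coloring of $G$ contains no blue connected $n$-matching. Suppose further that $\mathcal{B}$ is a largest blue component of $G$ (one with the maximum number of vertices) such that $|V(\mathcal{B})\cap V_i|\ge n$ for each $i\in\{1,2\}$. Let $S$ be a minimum vertex cover of $\mathcal{B}$. Then there is a red component of $G$ containing all vertices of $V(\mathcal{B})\setminus S$.
   Context: For a red-blue-edge-colored graph $G$, a red (resp. blue) component is a connected component of the spanning subgraph of $G$ formed by all red (resp. blue) edges; a blue component is regarded as a graph whose edges are the blue edges. A blue connected $k$-matching is a set of $k$ pairwise disjoint blue edges all lying in a single blue component. A vertex cover of a graph is a vertex set containing at least one endpoint of every edge. -}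

module Defs where

open import Data.Nat using (ℕ; zero; suc; _+_; _≤_)
open import Data.Bool using (Bool; true; false)
open import Data.Fin using (Fin; zero; suc)
open import Data.Maybe using (Maybe; just; nothing)
open import Data.Sum using (_⊎_; inj₁; inj₂)
open import Data.Product using (Σ; _×_; proj₁; proj₂)
open import Function.Bundles using (_⇔_)
open import Function.Definitions using (Injective)
open import Relation.Binary.PropositionalEquality using (_≡_)
open import Relation.Binary.Construct.Closure.ReflexiveTransitive using (Star)

data Colour : Set where
  red blue : Colour

-- A red-blue-edge-coloured bipartite graph G[V₁,V₂] with |V₁| = |V₂| = N:
-- V₁ = V₂ = Fin N, and  col i j = nothing  if i ∈ V₁, j ∈ V₂ are non-adjacent,
-- col i j = just c  if  ij  is an edge of colour c.
ColouredBip : ℕ → Set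
ColouredBip N = Fin N → Fin N → Maybe Colour

Vtx : ℕ → Set
Vtx N = Fin N ⊎ Fin N

countFin : {n : ℕ} → (Fin n → Bool) → ℕ
countFin {zero}  p = 0
countFin {suc n} p with p zero
... | true  = suc (countFin (λ i → p (suc i)))
... | false = countFin (λ i → p (suc i))

isEdge : Maybe Colour → Bool
isEdge nothing  = false
isEdge (just _) = true

degree : {N : ℕ} → ColouredBip N → Vtx N → ℕ
degree G (inj₁ i) = countFin (λ j → isEdge (G i j))
degree G (inj₂ j) = countFin (λ i → isEdge (G i j))

data Adj {N : ℕ} (G : ColouredBip N) (c : Colour) : Vtx N → Vtx N → Set where
  lr : ∀ i j → G i j ≡ just c → Adj G c (inj₁ i) (inj₂ j)
  rl : ∀ i j → G i j ≡ just c → Adj G c (inj₂ j) (inj₁ i)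

Conn : {N : ℕ} → ColouredBip N → Colour → Vtx N → Vtx N → Set
Conn G c = Star (Adj G c)

VSet : ℕ → Set
VSet N = Vtx N → Bool

_∈ᵛ_ : {N : ℕ} → Vtx N → VSet N → Set
v ∈ᵛ P = P v ≡ true

IsComponent : {N : ℕ} → ColouredBip N → Colour → VSet N → Set
IsComponent {N} G c P = Σ (Vtx N) λ r → (u : Vtx N) → (u ∈ᵛ P) ⇔ Conn G c r u

size : {N : ℕ} → VSet N → ℕ
size P = countFin (λ i → P (inj₁ i)) + countFin (λ j → P (inj₂ j))

size₁ size₂ : {N : ℕ} → VSet N → ℕ
size₁ P = countFin (λ i → P (inj₁ i))
size₂ P = countFin (λ j → P (inj₂ j))

-- A blue connected k-matching: k pairwise disjoint blue edges e_t = (i_t, j_t)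
-- (i_t ∈ V₁, j_t ∈ V₂) all lying in a single blue component.
BlueConnMatching : {N : ℕ} → ColouredBip N → ℕ → Set
BlueConnMatching {N} G k =
  Σ (Fin k → Fin N × Fin N) λ e →
    Injective _≡_ _≡_ (λ t → proj₁ (e t)) ×
    Injective _≡_ _≡_ (λ t → proj₂ (e t)) ×
    ((t : Fin k) → G (proj₁ (e t)) (proj₂ (e t)) ≡ just blue) ×
    Σ (VSet N) λ Q → IsComponent G blue Q ×
      ((t : Fin k) → inj₁ (proj₁ (e t)) ∈ᵛ Q)

-- S is a vertex cover of the blue component with vertex set B
-- (B regarded as a graph whose edges are the blue edges of G inside B):
-- S ⊆ V(B) and every blue edge with both ends in B has an end in S.
IsBlueCover : {N : ℕ} → ColouredBip N → VSet N → VSet N → Set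
IsBlueCover {N} G B S =
  ((v : Vtx N) → v ∈ᵛ S → v ∈ᵛ B) ×
  ((i j : Fin N) → G i j ≡ just blue → inj₁ i ∈ᵛ B → inj₂ j ∈ᵛ B →
     (inj₁ i ∈ᵛ S) ⊎ (inj₂ j ∈ᵛ S))

IsMinBlueCover : {N : ℕ} → ColouredBip N → VSet N → VSet N → Set
IsMinBlueCover {N} G B S =
  IsBlueCover G B S × ((T : VSet N) → IsBlueCover G B T → size S ≤ size T)

-- Let X and Y be the vertices of B outside the cover S, in V₁ and V₂. An edge from X to a
-- vertex of V₂ ∖ S is never blue (it would lie in the blue component B and be uncovered), so
-- it is red; symmetrically for Y. By König's exchange argument S ∩ V₂ can be matched into X
-- along blue edges (Hall's theorem), so |S ∩ V₂| < n since there is no blue connected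
-- n-matching; likewise |S ∩ V₁| < n. With N = m + n − 1 ≥ 2n, two vertices of X have more
-- than N/2 common neighbours, one of them outside S, so X is red-connected; likewise Y.
-- A vertex x ∈ X is red-linked to y ∈ Y at once if x has a neighbour in Y or y one in X.
-- Otherwise |X|, |Y| < N/4, so x and y each have more than N/2 neighbours outside B. A red
-- edge between these two neighbourhoods links x to y; if all of them were blue they would
-- span a blue component with more than N > |B| vertices and at least n on each side,
-- contradicting the choice of B.

module Submission where

open import Defs
open import Data.Nat using (ℕ; zero; suc; _+_; _*_; _∸_; _<_; _≤_; z≤n; s≤s; _<?_; _≤?_)
open import Data.Nat.Properties
  using ( ≤-trans; ≤-reflexive; ≤-total; ≤-pred; <-≤-trans; <⇒≤; <⇒≱; ≰⇒>; ≮⇒≥; n≮0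
        ; m≤n⇒m≤1+n; n≤1+n; m≤m+n; m≤n+m; m<m+n; +-suc; +-comm
        ; +-mono-≤; +-monoˡ-≤; +-monoʳ-≤; +-mono-<-≤; +-mono-≤-<; *-monoʳ-≤
        ; +-cancelˡ-≤; +-cancelʳ-≤; *-cancelˡ-≤; *-cancelˡ-<; module ≤-Reasoning )
open import Data.Nat.Tactic.RingSolver using (solve-∀)
open import Data.Bool using (Bool; true; false; _∧_; _∨_; not; if_then_else_)
import Data.Bool.Properties as Bool
open import Data.Fin using (Fin; zero; suc; _≟_)
open import Data.Fin.Properties using (suc-injective; all?; any?)
open import Data.Fin.Subset.Properties using (anySubset?)
open import Data.Vec using (lookup; tabulate)
open import Data.Vec.Properties using (lookup∘tabulate)
open import Data.Maybe using (Maybe; just)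
import Data.Maybe.Properties as Maybe
open import Data.Product using (Σ; ∃; _×_; _,_; proj₁; proj₂)
import Data.Product as ×
open import Data.Sum using (_⊎_; inj₁; inj₂; swap)
import Data.Sum.Properties as Sum
open import Data.Empty using (⊥; ⊥-elim)
open import Function using (_∘_; id; case_of_)
open import Function.Bundles using (mk⇔; Equivalence)
open import Function.Definitions using (Injective)
open import Relation.Nullary using (¬_; Dec; yes; no; does; map′; _×-dec_; _→-dec_)
open import Relation.Nullary.Decidable using (dec-true)
open import Relation.Binary.Definitions using (DecidableEquality)
open import Relation.Binary.PropositionalEquality
open import Relation.Binary.Construct.Closure.ReflexiveTransitive using (ε; _◅_; _◅◅_; gmap)

private variable
  n N k : ℕ
  I : Set
  p q : I → Bool
  G : ColouredBip N
  c : Colour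
  B S : VSet N

-- Boolean predicates and their cardinalities

infix 4 _⊆_
infixl 7 _∩_
infixl 6 _∪_ _─_

_⊆_ : (I → Bool) → (I → Bool) → Set
p ⊆ q = ∀ i → p i ≡ true → q i ≡ true

_∩_ _∪_ _─_ : (I → Bool) → (I → Bool) → I → Bool
(p ∩ q) i = p i ∧ q i
(p ∪ q) i = p i ∨ q i
(p ─ q) i = p i ∧ not (q i)

from-does : ∀ {a} {A : Set a} (d : Dec A) → does d ≡ true → A
from-does (yes a) _ = a

⁅_⁆ : Fin n → Fin n → Bool
⁅ a ⁆ i = does (a ≟ i)

∩⁺ : ∀ (p q : I → Bool) {i} → p i ≡ true → q i ≡ true → (p ∩ q) i ≡ true
∩⁺ p q pi qi rewrite pi | qi = refl

∩⁻ : ∀ (p q : I → Bool) {i} → (p ∩ q) i ≡ true → p i ≡ true × q i ≡ true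
∩⁻ p q {i} e with p i | q i
∩⁻ p q refl | true | true = refl , refl

─⁺ : ∀ (p q : I → Bool) {i} → p i ≡ true → q i ≡ false → (p ─ q) i ≡ true
─⁺ p q pi qi rewrite pi | qi = refl

─⁻ : ∀ (p q : I → Bool) {i} → (p ─ q) i ≡ true → p i ≡ true × q i ≡ false
─⁻ p q {i} e with p i | q i
─⁻ p q refl | true | false = refl , refl

∪⁺ˡ : ∀ (p q : I → Bool) {i} → p i ≡ true → (p ∪ q) i ≡ true
∪⁺ˡ p q pi rewrite pi = refl

∪⁺ʳ : ∀ (p q : I → Bool) {i} → q i ≡ true → (p ∪ q) i ≡ true
∪⁺ʳ p q {i} qi rewrite qi = Bool.∨-zeroʳ (p i)

∪⁻ : ∀ (p q : I → Bool) {i} → (p ∪ q) i ≡ true → p i ≡ true ⊎ q i ≡ true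
∪⁻ p q {i} e with p i
... | true  = inj₁ refl
... | false = inj₂ e

p⊆q∪p─q : (p q : I → Bool) → p ⊆ q ∪ (p ─ q)
p⊆q∪p─q p q i pi rewrite pi with q i
... | true  = refl
... | false = refl

a∈⁅a⁆ : (a : Fin n) → ⁅ a ⁆ a ≡ true
a∈⁅a⁆ a = dec-true (a ≟ a) refl

i∈⁅a⁆⇒a≡i : ∀ (a : Fin n) {i} → ⁅ a ⁆ i ≡ true → a ≡ i
i∈⁅a⁆⇒a≡i a {i} = from-does (a ≟ i)

p∩q⊆q : (p q : I → Bool) → p ∩ q ⊆ q
p∩q⊆q p q i = proj₂ ∘ ∩⁻ p q

p─q⊆p : (p q : I → Bool) → p ─ q ⊆ p
p─q⊆p p q i = proj₁ ∘ ─⁻ p q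

countFin-cong : (∀ i → p i ≡ q i) → countFin p ≡ countFin q
countFin-cong {zero} _ = refl
countFin-cong {suc n} {p} {q} e with p zero | q zero | e zero
... | true  | .true  | refl = cong suc (countFin-cong (e ∘ suc))
... | false | .false | refl = countFin-cong (e ∘ suc)

countFin≤n : (p : Fin n → Bool) → countFin p ≤ n
countFin≤n {zero} p = z≤n
countFin≤n {suc n} p with p zero
... | true  = s≤s (countFin≤n (p ∘ suc))
... | false = m≤n⇒m≤1+n (countFin≤n (p ∘ suc))

countFin-mono : p ⊆ q → countFin p ≤ countFin q
countFin-mono {zero} _ = z≤n
countFin-mono {suc n} {p} {q} p⊆q with p zero in pz | q zero in qz
... | true  | true  = s≤s (countFin-mono (p⊆q ∘ suc))
... | true  | false with () ← trans (sym qz) (p⊆q zero pz)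
... | false | true  = m≤n⇒m≤1+n (countFin-mono (p⊆q ∘ suc))
... | false | false = countFin-mono (p⊆q ∘ suc)

countFin-pos : ∀ i → p i ≡ true → 0 < countFin p
countFin-pos {p = p} zero e with p zero
countFin-pos zero refl | .true = s≤s z≤n
countFin-pos {p = p} (suc i) e with p zero
... | true  = s≤s z≤n
... | false = countFin-pos i e

countFin-witness : 0 < countFin p → ∃ λ i → p i ≡ true
countFin-witness {zero} ()
countFin-witness {suc n} {p} pos with p zero in pz
... | true  = zero , pz
... | false with countFin-witness pos
...   | i , e = suc i , e

countFin-split : (p q : Fin n → Bool) → countFin p ≡ countFin (p ─ q) + countFin (p ∩ q)
countFin-split {zero} p q = refl
countFin-split {suc n} p q with p zero | q zero | countFin-split (p ∘ suc) (q ∘ suc)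
... | true  | true  | e = trans (cong suc e) (sym (+-suc _ _))
... | true  | false | e = cong suc e
... | false | true  | e = e
... | false | false | e = e

countFin-⊆ : p ⊆ q → countFin q ≡ countFin (q ─ p) + countFin p
countFin-⊆ {p = p} {q} p⊆q =
  trans (countFin-split q p) (cong (countFin (q ─ p) +_) (countFin-cong q∩p≗p))
  where
  q∩p≗p : ∀ i → (q ∩ p) i ≡ p i
  q∩p≗p i with p i in pi | q i in qi
  ... | true  | true  = refl
  ... | true  | false with () ← trans (sym qi) (p⊆q i pi)
  ... | false | true  = refl
  ... | false | false = refl

countFin-⊂ : p ⊆ q → ∀ i → q i ≡ true → p i ≡ false → countFin p < countFin q
countFin-⊂ {p = p} {q} p⊆q i qi pi rewrite countFin-⊆ p⊆q =
  +-monoˡ-≤ (countFin p) (countFin-pos i (─⁺ q p qi pi))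

countFin-<⇒witness : countFin q < countFin p → ∃ λ i → p i ≡ true × q i ≡ false
countFin-<⇒witness {q = q} {p = p} q<p =
  let i , e = countFin-witness {p = p ─ q} (≰⇒> p─q≰0) in i , ─⁻ p q e
  where
  p─q≰0 : countFin (p ─ q) ≤ 0 → ⊥
  p─q≰0 p─q≤0 = <⇒≱ q<p (begin
    countFin p                           ≡⟨ countFin-split p q ⟩
    countFin (p ─ q) + countFin (p ∩ q)  ≤⟨ +-mono-≤ p─q≤0 (countFin-mono (p∩q⊆q p q)) ⟩
    countFin q                           ∎)
    where open ≤-Reasoning

countFin-∪ : (∀ i → p i ≡ true → q i ≡ false) → countFin (p ∪ q) ≡ countFin p + countFin q
countFin-∪ {zero} _ = refl
countFin-∪ {suc n} {p} {q} disj with p zero in pz | q zero in qz | countFin-∪ {p = p ∘ suc} {q ∘ suc} (disj ∘ suc)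
... | true  | true  | _ with () ← trans (sym qz) (disj zero pz)
... | true  | false | e = cong suc e
... | false | true  | e = trans (cong suc e) (sym (+-suc _ _))
... | false | false | e = e

countFin-∪-≤ : (p q : Fin n → Bool) → countFin (p ∪ q) ≤ countFin p + countFin q
countFin-∪-≤ {zero} p q = z≤n
countFin-∪-≤ {suc n} p q with p zero | q zero | countFin-∪-≤ (p ∘ suc) (q ∘ suc)
... | true  | true  | le = s≤s (≤-trans le (≤-trans (n≤1+n _) (≤-reflexive (sym (+-suc _ _)))))
... | true  | false | le = s≤s le
... | false | true  | le = ≤-trans (s≤s le) (≤-reflexive (sym (+-suc _ _)))
... | false | false | le = le

countFin-∩ : (p q : Fin n → Bool) → countFin p + countFin q ≤ countFin (p ∩ q) + n
countFin-∩ {zero} p q = z≤n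
countFin-∩ {suc n} p q with p zero | q zero | countFin-∩ (p ∘ suc) (q ∘ suc)
... | true  | true  | le rewrite +-suc (countFin (p ∘ suc)) (countFin (q ∘ suc))
                          | +-suc (countFin ((p ∘ suc) ∩ (q ∘ suc))) n = s≤s (s≤s le)
... | true  | false | le rewrite +-suc (countFin ((p ∘ suc) ∩ (q ∘ suc))) n = s≤s le
... | false | true  | le rewrite +-suc (countFin (p ∘ suc)) (countFin (q ∘ suc))
                          | +-suc (countFin ((p ∘ suc) ∩ (q ∘ suc))) n = s≤s le
... | false | false | le rewrite +-suc (countFin ((p ∘ suc) ∩ (q ∘ suc))) n = m≤n⇒m≤1+n le

countFin-∩-nonempty : (p q : Fin n → Bool) → n < countFin p + countFin q → ∃ λ i → (p ∩ q) i ≡ true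
countFin-∩-nonempty {n} p q n<p+q = countFin-witness (≰⇒> λ p∩q≤0 →
  <⇒≱ (<-≤-trans n<p+q (countFin-∩ p q)) (+-monoˡ-≤ n p∩q≤0))

countFin-none : (∀ i → p i ≡ false) → countFin p ≡ 0
countFin-none {zero} _ = refl
countFin-none {suc n} {p} none with p zero | none zero
... | .false | refl = countFin-none (none ∘ suc)

countFin-⁅⁆ : (a : Fin n) → countFin ⁅ a ⁆ ≡ 1
countFin-⁅⁆ {suc n} zero = cong suc (countFin-none {n} (λ _ → refl))
countFin-⁅⁆ {suc n} (suc a) = countFin-⁅⁆ a

choose : (p : Fin n → Bool) (k : ℕ) → k ≤ countFin p →
  Σ (Fin k → Fin n) λ g → (∀ t → p (g t) ≡ true) × Injective _≡_ _≡_ g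
choose p zero _ = (λ ()) , (λ ()) , λ {}
choose {suc n} p (suc k) k<p with p zero in pz
... | true with choose (p ∘ suc) k (≤-pred k<p)
...   | g , pg , g-inj = g′ , pg′ , g′-inj
  where
  g′ : Fin (suc k) → Fin (suc n)
  g′ zero    = zero
  g′ (suc t) = suc (g t)
  pg′ : ∀ t → p (g′ t) ≡ true
  pg′ zero    = pz
  pg′ (suc t) = pg t
  g′-inj : Injective _≡_ _≡_ g′
  g′-inj {zero}  {zero}  _ = refl
  g′-inj {suc s} {suc t} e = cong suc (g-inj (suc-injective e))
choose {suc n} p (suc k) k<p | false with choose (p ∘ suc) (suc k) k<p
... | g , pg , g-inj = suc ∘ g , pg , g-inj ∘ suc-injective

anyFin : (Fin n → Bool) → Bool
anyFin {zero}  p = false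
anyFin {suc n} p = p zero ∨ anyFin (p ∘ suc)

anyFin⁺ : ∀ i → p i ≡ true → anyFin p ≡ true
anyFin⁺ {p = p} zero    e rewrite e = refl
anyFin⁺ {p = p} (suc i) e rewrite anyFin⁺ {p = p ∘ suc} i e = Bool.∨-zeroʳ (p zero)

anyFin⁻ : anyFin p ≡ true → ∃ λ i → p i ≡ true
anyFin⁻ {suc n} {p} e with p zero in pz
... | true  = zero , pz
... | false with anyFin⁻ {p = p ∘ suc} e
...   | i , pi = suc i , pi

anyFin-cong : (∀ i → p i ≡ q i) → anyFin p ≡ anyFin q
anyFin-cong {zero}  _ = refl
anyFin-cong {suc n} e = cong₂ _∨_ (e zero) (anyFin-cong (e ∘ suc))

-- Hall's theorem

Graph : ℕ → Set
Graph n = Fin n → Fin n → Bool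

Nbh : Graph n → (Fin n → Bool) → Fin n → Bool
Nbh E A j = anyFin (λ i → A i ∧ E i j)

Nbh⁺ : ∀ (E : Graph n) A {i j} → A i ≡ true → E i j ≡ true → Nbh E A j ≡ true
Nbh⁺ E A {i} {j} Ai Eij = anyFin⁺ {p = λ i → A i ∧ E i j} i (∩⁺ A (λ i → E i j) Ai Eij)

Nbh⁻ : ∀ (E : Graph n) A {j} → Nbh E A j ≡ true → ∃ λ i → A i ≡ true × E i j ≡ true
Nbh⁻ E A {j} e with anyFin⁻ e
... | i , e′ = i , ∩⁻ A (λ i → E i j) e′

HallCondition : Graph n → (Fin n → Bool) → Set
HallCondition E A = ∀ A′ → A′ ⊆ A → countFin A′ ≤ countFin (Nbh E A′)

record Saturating (E : Graph n) (A : Fin n → Bool) : Set where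
  field
    match           : Fin n → Fin n
    match-edge      : ∀ i → A i ≡ true → E i (match i) ≡ true
    match-injective : ∀ {i i′} → A i ≡ true → A i′ ≡ true → match i ≡ match i′ → i ≡ i′

avoiding : Graph n → (Fin n → Bool) → Graph n
avoiding E P i j = E i j ∧ not (P j)

HallCondition-⊆ : ∀ {E : Graph n} {A A′} → A′ ⊆ A → HallCondition E A → HallCondition E A′
HallCondition-⊆ A′⊆A hc A″ A″⊆A′ = hc A″ (λ i → A′⊆A i ∘ A″⊆A′ i)

Saturating-⊆ : ∀ {E : Graph n} {A A′} → A′ ⊆ A → Saturating E A → Saturating E A′
Saturating-⊆ A′⊆A σ = record
  { match           = match
  ; match-edge      = λ i → match-edge i ∘ A′⊆A i
  ; match-injective = λ Ai Ai′ → match-injective (A′⊆A _ Ai) (A′⊆A _ Ai′)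
  }
  where open Saturating σ

Nbh-avoiding : ∀ (E : Graph n) {A A₀ P} →
  (∀ {i j} → A i ≡ true → E i j ≡ true → A₀ i ≡ true ⊎ P j ≡ true) →
  Nbh E A ⊆ Nbh (avoiding E P) A₀ ∪ P
Nbh-avoiding E {A} {A₀} {P} split j e with Nbh⁻ E A e
... | i , Ai , Eij with P j Bool.≟ true | split Ai Eij
...   | yes Pj | _        = ∪⁺ʳ (Nbh (avoiding E P) A₀) P Pj
...   | no ¬Pj | inj₁ A₀i =
  ∪⁺ˡ (Nbh (avoiding E P) A₀) P (Nbh⁺ (avoiding E P) A₀ A₀i (─⁺ (E i) P Eij (Bool.¬-not ¬Pj)))
...   | no ¬Pj | inj₂ Pj  = ⊥-elim (¬Pj Pj)

Saturating-∪ : ∀ {E : Graph n} {A₁ A₂ P} (σ₁ : Saturating E A₁) →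
  (∀ i → A₁ i ≡ true → P (Saturating.match σ₁ i) ≡ true) →
  Saturating (avoiding E P) A₂ → Saturating E (A₁ ∪ A₂)
Saturating-∪ {n} {E} {A₁} {A₂} {P} σ₁ lands-in-P σ₂ = record
  { match = match ; match-edge = match-edge ; match-injective = match-injective }
  where
  module σ₁ = Saturating σ₁
  module σ₂ = Saturating σ₂

  match : Fin n → Fin n
  match i = if A₁ i then σ₁.match i else σ₂.match i

  avoids-P : ∀ {i} → A₂ i ≡ true → P (σ₂.match i) ≡ false
  avoids-P {i} A₂i = proj₂ (─⁻ (E i) P (σ₂.match-edge i A₂i))

  match-edge : ∀ i → (A₁ ∪ A₂) i ≡ true → E i (match i) ≡ true
  match-edge i e with A₁ i in A₁i
  ... | true  = σ₁.match-edge i A₁i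
  ... | false = proj₁ (─⁻ (E i) P (σ₂.match-edge i e))

  match-injective : ∀ {i i′} → (A₁ ∪ A₂) i ≡ true → (A₁ ∪ A₂) i′ ≡ true → match i ≡ match i′ → i ≡ i′
  match-injective {i} {i′} e e′ same with A₁ i in A₁i | A₁ i′ in A₁i′
  ... | true  | true  = σ₁.match-injective A₁i A₁i′ same
  ... | false | false = σ₂.match-injective e e′ same
  ... | true  | false with () ← trans (sym (subst (λ j → P j ≡ true) same (lands-in-P i A₁i))) (avoids-P e′)
  ... | false | true  with () ← trans (sym (subst (λ j → P j ≡ true) (sym same) (lands-in-P i′ A₁i′))) (avoids-P e)

Tight : Graph n → (Fin n → Bool) → (Fin n → Bool) → Set
Tight E A A′ = A′ ⊆ A × 0 < countFin A′ × countFin A′ < countFin A × countFin (Nbh E A′) ≤ countFin A′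

tight? : (E : Graph n) (A A′ : Fin n → Bool) → Dec (Tight E A A′)
tight? E A A′ =
  all? (λ i → A′ i Bool.≟ true →-dec A i Bool.≟ true) ×-dec
  0 <? countFin A′ ×-dec countFin A′ <? countFin A ×-dec countFin (Nbh E A′) ≤? countFin A′

Tight-cong : ∀ {E : Graph n} {A A′ A″} → (∀ i → A′ i ≡ A″ i) → Tight E A A′ → Tight E A A″
Tight-cong {E = E} {A} {A′} {A″} A′≗A″ (A′⊆A , pos , A′<A , tight) =
  (λ i → A′⊆A i ∘ trans (A′≗A″ i)) ,
  subst (0 <_) count≡ pos ,
  subst (_< countFin A) count≡ A′<A ,
  subst₂ _≤_ (countFin-cong (λ j → anyFin-cong (λ i → cong (_∧ E i j) (A′≗A″ i)))) count≡ tight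
  where
  count≡ : countFin A′ ≡ countFin A″
  count≡ = countFin-cong A′≗A″

tight-or-loose : ∀ (E : Graph n) A → ∃ (Tight E A) ⊎ (∀ A′ → ¬ Tight E A A′)
tight-or-loose E A with anySubset? (tight? E A ∘ lookup)
... | yes (s , t) = inj₁ (lookup s , t)
... | no none     = inj₂ λ A′ t → none (tabulate A′ , Tight-cong (λ i → sym (lookup∘tabulate A′ i)) t)

Saturating-∅ : ∀ {E : Graph n} {A} → (∀ i → A i ≢ true) → Saturating E A
Saturating-∅ empty = record
  { match = id ; match-edge = λ i Ai → ⊥-elim (empty i Ai) ; match-injective = λ Ai → ⊥-elim (empty _ Ai) }

Saturating-⁅⁆ : ∀ {E : Graph n} {a r} → E a r ≡ true → Saturating E ⁅ a ⁆
Saturating-⁅⁆ {E = E} {a} {r} Ear = record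
  { match           = λ _ → r
  ; match-edge      = λ i a≡i → subst (λ i → E i r ≡ true) (i∈⁅a⁆⇒a≡i a a≡i) Ear
  ; match-injective = λ a≡i a≡i′ _ → trans (sym (i∈⁅a⁆⇒a≡i a a≡i)) (i∈⁅a⁆⇒a≡i a a≡i′)
  }

Saturation : ℕ → ℕ → Set
Saturation n k = ∀ (E : Graph n) A → countFin A ≤ k → HallCondition E A → Saturating E A

-- Split off a tight set A′: its neighbourhood is used up by A′, and Hall's condition
-- survives for the rest in the graph avoiding that neighbourhood.
hall-tight : ∀ {k} → Saturation n k → ∀ (E : Graph n) A A′ → Tight E A A′ →
  countFin A ≤ suc k → HallCondition E A → Saturating E A
hall-tight rec E A A′ (A′⊆A , A′>0 , A′<A , NA′≤A′) A≤ hc =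
  Saturating-⊆ (p⊆q∪p─q A A′) (Saturating-∪ σ₁ (λ i A′i → Nbh⁺ E A′ A′i (Saturating.match-edge σ₁ i A′i)) σ₂)
  where
  P = Nbh E A′
  σ₁ = rec E A′ (≤-pred (≤-trans A′<A A≤)) (HallCondition-⊆ A′⊆A hc)

  rest≤ : countFin (A ─ A′) < countFin A
  rest≤ = subst (countFin (A ─ A′) <_) (sym (countFin-⊆ A′⊆A)) (m<m+n _ A′>0)

  rest-hall : HallCondition (avoiding E P) (A ─ A′)
  rest-hall A″ A″⊆ = +-cancelʳ-≤ (countFin A′) _ _ (begin
    countFin A″ + countFin A′   ≡⟨ countFin-∪ disjoint ⟨
    countFin (A″ ∪ A′)          ≤⟨ hc (A″ ∪ A′) A″∪A′⊆A ⟩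
    countFin (Nbh E (A″ ∪ A′))  ≤⟨ countFin-mono (Nbh-avoiding E split) ⟩
    countFin (N′ ∪ P)           ≤⟨ countFin-∪-≤ N′ P ⟩
    countFin N′ + countFin P    ≤⟨ +-monoʳ-≤ (countFin N′) NA′≤A′ ⟩
    countFin N′ + countFin A′   ∎)
    where
    open ≤-Reasoning
    N′ = Nbh (avoiding E P) A″
    disjoint : ∀ i → A″ i ≡ true → A′ i ≡ false
    disjoint i = proj₂ ∘ ─⁻ A A′ ∘ A″⊆ i
    A″∪A′⊆A : A″ ∪ A′ ⊆ A
    A″∪A′⊆A i e with ∪⁻ A″ A′ e
    ... | inj₁ A″i = proj₁ (─⁻ A A′ (A″⊆ i A″i))
    ... | inj₂ A′i = A′⊆A i A′i
    split : ∀ {i j} → (A″ ∪ A′) i ≡ true → E i j ≡ true → A″ i ≡ true ⊎ P j ≡ true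
    split e Eij with ∪⁻ A″ A′ e
    ... | inj₁ A″i = inj₁ A″i
    ... | inj₂ A′i = inj₂ (Nbh⁺ E A′ A′i Eij)

  σ₂ = rec (avoiding E P) (A ─ A′) (≤-pred (≤-trans rest≤ A≤)) rest-hall

-- Without tight sets every proper part of A has a surplus neighbour, so matching one
-- vertex a to a neighbour r and deleting r keeps Hall's condition for A ∖ {a}.
hall-loose : ∀ {k} → Saturation n k → ∀ (E : Graph n) A a → A a ≡ true → (∀ A′ → ¬ Tight E A A′) →
  countFin A ≤ suc k → HallCondition E A → Saturating E A
hall-loose rec E A a Aa loose A≤ hc =
  Saturating-⊆ (p⊆q∪p─q A ⁅ a ⁆) (Saturating-∪ (Saturating-⁅⁆ Ear) (λ _ _ → a∈⁅a⁆ r) σ₂)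
  where
  ⁅a⁆⊆A : ⁅ a ⁆ ⊆ A
  ⁅a⁆⊆A i a≡i = subst (λ i → A i ≡ true) (i∈⁅a⁆⇒a≡i a a≡i) Aa

  neighbour : ∃ λ r → E a r ≡ true
  neighbour with countFin-witness (≤-trans (≤-reflexive (sym (countFin-⁅⁆ a))) (hc ⁅ a ⁆ ⁅a⁆⊆A))
  ... | r , e with Nbh⁻ E ⁅ a ⁆ e
  ...   | i , a≡i , Eir = r , subst (λ i → E i r ≡ true) (sym (i∈⁅a⁆⇒a≡i a a≡i)) Eir
  r = proj₁ neighbour
  Ear = proj₂ neighbour

  rest-count : countFin A ≡ suc (countFin (A ─ ⁅ a ⁆))
  rest-count = trans (countFin-⊆ ⁅a⁆⊆A) (trans (cong (countFin (A ─ ⁅ a ⁆) +_) (countFin-⁅⁆ a)) (+-comm _ 1))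

  rest-hall : HallCondition (avoiding E ⁅ r ⁆) (A ─ ⁅ a ⁆)
  rest-hall A″ A″⊆ with 0 <? countFin A″
  ... | no  A″-empty = ≤-trans (≮⇒≥ A″-empty) z≤n
  ... | yes A″>0 = ≤-pred (begin
    suc (countFin A″)                 ≤⟨ ≰⇒> (λ N≤A″ → loose A″ (A″⊆A , A″>0 , A″<A , N≤A″)) ⟩
    countFin (Nbh E A″)               ≤⟨ countFin-mono (Nbh-avoiding E {A″} {A″} {⁅ r ⁆} (λ A″i _ → inj₁ A″i)) ⟩
    countFin (N′ ∪ ⁅ r ⁆)             ≤⟨ countFin-∪-≤ N′ ⁅ r ⁆ ⟩
    countFin N′ + countFin ⁅ r ⁆      ≡⟨ cong (countFin N′ +_) (countFin-⁅⁆ r) ⟩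
    countFin N′ + 1                   ≡⟨ +-comm _ 1 ⟩
    suc (countFin N′)                 ∎)
    where
    open ≤-Reasoning
    N′ = Nbh (avoiding E ⁅ r ⁆) A″
    A″⊆A : A″ ⊆ A
    A″⊆A i = p─q⊆p A ⁅ a ⁆ i ∘ A″⊆ i
    A″<A : countFin A″ < countFin A
    A″<A = countFin-⊂ A″⊆A a Aa (Bool.¬-not λ A″a → case trans (sym (a∈⁅a⁆ a)) (proj₂ (─⁻ A ⁅ a ⁆ (A″⊆ a A″a))) of λ ())

  σ₂ = rec (avoiding E ⁅ r ⁆) (A ─ ⁅ a ⁆) (≤-pred (≤-trans (≤-reflexive (sym rest-count)) A≤)) rest-hall

saturation : ∀ k → Saturation n k
saturation zero E A A≤0 _ = Saturating-∅ λ i Ai → n≮0 (≤-trans (countFin-pos i Ai) A≤0)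
saturation (suc k) E A A≤ hc with any? (λ i → A i Bool.≟ true)
... | no empty = Saturating-∅ λ i Ai → empty (i , Ai)
... | yes (a , Aa) with tight-or-loose E A
...   | inj₁ (A′ , tight) = hall-tight (saturation k) E A A′ tight A≤ hc
...   | inj₂ loose        = hall-loose (saturation k) E A a Aa loose A≤ hc

hall : ∀ (E : Graph n) A → HallCondition E A → Saturating E A
hall E A = saturation _ E A (countFin≤n A)

-- Connected components

_≟ᶜ_ : DecidableEquality Colour
red  ≟ᶜ red  = yes refl
red  ≟ᶜ blue = no λ ()
blue ≟ᶜ red  = no λ ()
blue ≟ᶜ blue = yes refl

_≟ᵛ_ : DecidableEquality (Vtx N)
_≟ᵛ_ = Sum.≡-dec _≟_ _≟_

module _ {N : ℕ} (G : ColouredBip N) (c : Colour) where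

  Closed : VSet N → Set
  Closed P = ∀ {u v} → u ∈ᵛ P → Adj G c u v → v ∈ᵛ P

  Closed-Conn : ∀ {P} → Closed P → ∀ {u v} → u ∈ᵛ P → Conn G c u v → v ∈ᵛ P
  Closed-Conn closed u∈P ε          = u∈P
  Closed-Conn closed u∈P (uv ◅ vw) = Closed-Conn closed (closed u∈P uv) vw

  IsComponent⇒Closed : ∀ {P} → IsComponent G c P → Closed P
  IsComponent⇒Closed (r , P⇔Conn) {u} {v} u∈P uv =
    Equivalence.from (P⇔Conn v) (Equivalence.to (P⇔Conn u) u∈P ◅◅ uv ◅ ε)

  adj? : ∀ u v → Dec (Adj G c u v)
  adj? (inj₁ i) (inj₂ j) = map′ (lr i j) (λ { (lr _ _ e) → e }) (Maybe.≡-dec _≟ᶜ_ (G i j) (just c))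
  adj? (inj₂ j) (inj₁ i) = map′ (rl i j) (λ { (rl _ _ e) → e }) (Maybe.≡-dec _≟ᶜ_ (G i j) (just c))
  adj? (inj₁ _) (inj₁ _) = no λ ()
  adj? (inj₂ _) (inj₂ _) = no λ ()

  anyVtx : (Vtx N → Bool) → Bool
  anyVtx p = anyFin (p ∘ inj₁) ∨ anyFin (p ∘ inj₂)

  anyVtx⁺ : ∀ p v → p v ≡ true → anyVtx p ≡ true
  anyVtx⁺ p (inj₁ i) e rewrite anyFin⁺ {p = p ∘ inj₁} i e = refl
  anyVtx⁺ p (inj₂ j) e rewrite anyFin⁺ {p = p ∘ inj₂} j e = Bool.∨-zeroʳ (anyFin (p ∘ inj₁))

  anyVtx⁻ : ∀ p → anyVtx p ≡ true → ∃ λ v → p v ≡ true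
  anyVtx⁻ p e with anyFin (p ∘ inj₁) in e₁
  ... | true  = let i , pi = anyFin⁻ e₁ in inj₁ i , pi
  ... | false = let j , pj = anyFin⁻ e  in inj₂ j , pj

  adjacent : VSet N → VSet N
  adjacent P v = anyVtx (λ u → P u ∧ does (adj? u v))

  step : VSet N → VSet N
  step P = P ∪ adjacent P

  step⁺ : ∀ {P u v} → u ∈ᵛ P → Adj G c u v → v ∈ᵛ step P
  step⁺ {P} {u} {v} u∈P uv = ∪⁺ʳ P (adjacent P)
    (anyVtx⁺ (λ u → P u ∧ does (adj? u v)) u (∩⁺ P (λ u → does (adj? u v)) u∈P (dec-true (adj? u v) uv)))

  reach : Vtx N → ℕ → VSet N
  reach r zero    v = does (r ≟ᵛ v)
  reach r (suc k) = step (reach r k)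

  reach-root : ∀ r k → r ∈ᵛ reach r k
  reach-root r zero    = dec-true (r ≟ᵛ r) refl
  reach-root r (suc k) = ∪⁺ˡ (reach r k) (adjacent (reach r k)) (reach-root r k)

  reach-sound : ∀ r k {v} → v ∈ᵛ reach r k → Conn G c r v
  reach-sound r zero {v} e with from-does (r ≟ᵛ v) e
  ... | refl = ε
  reach-sound r (suc k) {v} e with ∪⁻ (reach r k) (adjacent (reach r k)) e
  ... | inj₁ e₀ = reach-sound r k e₀
  ... | inj₂ e₁ with anyVtx⁻ (λ u → reach r k u ∧ does (adj? u v)) e₁
  ...   | u , e₂ with ∩⁻ (reach r k) (λ u → does (adj? u v)) e₂
  ...     | u∈reach , uv = reach-sound r k u∈reach ◅◅ from-does (adj? u v) uv ◅ ε

  size-⊂ : ∀ {P Q : VSet N} → P ⊆ Q → ∀ v → v ∈ᵛ Q → P v ≡ false → size P < size Q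
  size-⊂ P⊆Q (inj₁ i) Qv Pv = +-mono-<-≤ (countFin-⊂ (P⊆Q ∘ inj₁) i Qv Pv) (countFin-mono (P⊆Q ∘ inj₂))
  size-⊂ P⊆Q (inj₂ j) Qv Pv = +-mono-≤-< (countFin-mono (P⊆Q ∘ inj₁)) (countFin-⊂ (P⊆Q ∘ inj₂) j Qv Pv)

  size≤ : (P : VSet N) → size P ≤ N + N
  size≤ P = +-mono-≤ (countFin≤n (P ∘ inj₁)) (countFin≤n (P ∘ inj₂))

  Closed-or-grows : ∀ P → Closed P ⊎ size P < size (step P)
  Closed-or-grows P with anyVtx (step P ─ P) in e
  ... | true  = let v , e′ = anyVtx⁻ (step P ─ P) e ; step-v , ¬Pv = ─⁻ (step P) P e′ in
                inj₂ (size-⊂ {P} {step P} (λ v → ∪⁺ˡ P (adjacent P)) v step-v ¬Pv)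
  ... | false = inj₁ closed
    where
    closed : Closed P
    closed {u} {v} u∈P uv with P v Bool.≟ true
    ... | yes v∈P = v∈P
    ... | no  v∉P with () ← trans (sym e) (anyVtx⁺ (step P ─ P) v (─⁺ (step P) P (step⁺ {P} u∈P uv) (Bool.¬-not v∉P)))

  size-pos : ∀ {P : VSet N} v → v ∈ᵛ P → 0 < size P
  size-pos {P} (inj₁ i) Pv = ≤-trans (countFin-pos i Pv) (m≤m+n _ _)
  size-pos {P} (inj₂ j) Pv = ≤-trans (countFin-pos j Pv) (m≤n+m _ _)

  reach-closes : ∀ r k → (∃ λ j → Closed (reach r j)) ⊎ k < size (reach r k)
  reach-closes r zero = inj₂ (size-pos {reach r 0} r (reach-root r 0))
  reach-closes r (suc k) with reach-closes r k
  ... | inj₁ closes = inj₁ closes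
  ... | inj₂ k<size with Closed-or-grows (reach r k)
  ...   | inj₁ closed = inj₁ (k , closed)
  ...   | inj₂ grows  = inj₂ (≤-trans (s≤s k<size) grows)

  component-of : (r : Vtx N) → Σ (VSet N) λ P → IsComponent G c P × r ∈ᵛ P
  component-of r with reach-closes r (N + N)
  ... | inj₂ overflow     = ⊥-elim (<⇒≱ overflow (size≤ (reach r (N + N))))
  ... | inj₁ (k , closed) =
    reach r k , (r , λ v → mk⇔ (reach-sound r k) (Closed-Conn closed (reach-root r k))) , reach-root r k

-- Exchanging the two sides

_ᵀ : ColouredBip N → ColouredBip N
(G ᵀ) i j = G j i

Adjᵀ : ∀ {u v} → Adj G c u v → Adj (G ᵀ) c (swap u) (swap v)
Adjᵀ (lr i j e) = rl j i e
Adjᵀ (rl i j e) = lr j i e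

Connᵀ : ∀ {u v} → Conn G c u v → Conn (G ᵀ) c (swap u) (swap v)
Connᵀ = gmap swap Adjᵀ

IsComponentᵀ : ∀ {P} → IsComponent G c P → IsComponent (G ᵀ) c (P ∘ swap)
IsComponentᵀ {G = G} {c} {P} (r , P⇔Conn) = swap r , λ u → mk⇔
  (λ u∈P → subst (Conn (G ᵀ) c (swap r)) (Sum.swap-involutive u) (Connᵀ (Equivalence.to (P⇔Conn (swap u)) u∈P)))
  (λ r-u → Equivalence.from (P⇔Conn (swap u)) (subst (λ r → Conn G c r (swap u)) (Sum.swap-involutive r) (Connᵀ r-u)))

size-swap : (P : VSet N) → size (P ∘ swap) ≡ size P
size-swap P = +-comm (size₂ P) (size₁ P)

IsBlueCoverᵀ : IsBlueCover G B S → IsBlueCover (G ᵀ) (B ∘ swap) (S ∘ swap)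
IsBlueCoverᵀ (S⊆B , covers) = S⊆B ∘ swap , λ i j e Bi Bj → swap (covers j i e Bj Bi)

IsBlueCoverᵀ⁻ : ∀ {T} → IsBlueCover (G ᵀ) (B ∘ swap) T → IsBlueCover G B (T ∘ swap)
IsBlueCoverᵀ⁻ (T⊆B , covers) = (λ { (inj₁ i) → T⊆B (inj₂ i) ; (inj₂ j) → T⊆B (inj₁ j) }) ,
                               λ i j e Bi Bj → swap (covers j i e Bj Bi)

IsMinBlueCoverᵀ : IsMinBlueCover G B S → IsMinBlueCover (G ᵀ) (B ∘ swap) (S ∘ swap)
IsMinBlueCoverᵀ {S = S} (cover , minimal) = IsBlueCoverᵀ cover , λ T T-cover →
  ≤-trans (≤-reflexive (size-swap S)) (≤-trans (minimal _ (IsBlueCoverᵀ⁻ T-cover)) (≤-reflexive (size-swap T)))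

BlueConnMatchingᵀ : BlueConnMatching (G ᵀ) k → BlueConnMatching G k
BlueConnMatchingᵀ {G = G} (e , inj₁-inj , inj₂-inj , is-blue , Q , Q-component , in-Q) =
  ×.swap ∘ e , inj₂-inj , inj₁-inj , is-blue , Q ∘ swap , IsComponentᵀ Q-component ,
  λ t → IsComponent⇒Closed (G ᵀ) blue Q-component (in-Q t) (lr _ _ (is-blue t))

-- Arithmetic

-- The linear inequalities below add up their hypotheses and cancel a common summand K;
-- matching both sides against K + _ is a ring normalisation.
cancel : ∀ {L R} K {a b} → L ≤ R → L ≡ K + a → R ≡ K + b → a ≤ b
cancel K L≤R L≡ R≡ = +-cancelˡ-≤ K _ _ (subst₂ _≤_ L≡ R≡ L≤R)

n+n≤m+n∸1 : ∀ {m n} → n < m → n + n ≤ m + n ∸ 1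
n+n≤m+n∸1 {suc m} {n} (s≤s n≤m) = +-monoˡ-≤ n n≤m

half-< : ∀ {N n} c → n + n ≤ N → N < c + c → n < c
half-< c n+n≤N N<c+c = ≰⇒> λ c≤n → <⇒≱ N<c+c (≤-trans (+-mono-≤ c≤n c≤n) n+n≤N)

half+half : ∀ {N} a b → N < a + a → N < b + b → N < a + b
half+half a b N<a+a N<b+b with ≤-total a b
... | inj₁ a≤b = ≤-trans N<a+a (+-monoʳ-≤ a a≤b)
... | inj₂ b≤a = ≤-trans N<b+b (+-monoˡ-≤ b b≤a)

overlap-large : ∀ N a b c → 3 * N < 4 * a → 3 * N < 4 * b → a + b ≤ c + N → N < c + c
overlap-large N a b c a-large b-large a+b≤ = *-cancelˡ-≤ 2 (cancel (4 * a + 4 * b + 4 * N)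
  (+-mono-≤ (+-mono-≤ a-large b-large) (*-monoʳ-≤ 4 a+b≤)) (lhs N a b) (rhs N a b c))
  where
  lhs : ∀ N a b → suc (3 * N) + suc (3 * N) + 4 * (a + b) ≡ 4 * a + 4 * b + 4 * N + 2 * suc N
  lhs = solve-∀
  rhs : ∀ N a b c → 4 * a + 4 * b + 4 * (c + N) ≡ 4 * a + 4 * b + 4 * N + 2 * (c + c)
  rhs = solve-∀

complement-small : ∀ N d y → 3 * N < 4 * d → y + d ≤ N → 4 * y < N
complement-small N d y d-large y+d≤N = cancel (4 * d + 3 * N)
  (+-mono-≤ d-large (*-monoʳ-≤ 4 y+d≤N)) (lhs N d y) (rhs N d)
  where
  lhs : ∀ N d y → suc (3 * N) + 4 * (y + d) ≡ 4 * d + 3 * N + suc (4 * y)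
  lhs = solve-∀
  rhs : ∀ N d → 4 * d + 4 * N ≡ 4 * d + 3 * N + N
  rhs = solve-∀

large-minus-small : ∀ N d z s → 3 * N < 4 * d → d ≤ z + s → 4 * s < N → N < z + z
large-minus-small N d z s d-large d≤z+s s-small = *-cancelˡ-≤ 2 (cancel (4 * d + 4 * s + N)
  (+-mono-≤ d-large (+-mono-≤ (*-monoʳ-≤ 4 d≤z+s) s-small)) (lhs N d s) (rhs N d z s))
  where
  lhs : ∀ N d s → suc (3 * N) + (4 * d + suc (4 * s)) ≡ 4 * d + 4 * s + N + 2 * suc N
  lhs = solve-∀
  rhs : ∀ N d z s → 4 * d + (4 * (z + s) + N) ≡ 4 * d + 4 * s + N + 2 * (z + z)
  rhs = solve-∀

large+half : ∀ N d z → 3 * N < 4 * d → N < z + z → N < d + z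
large+half N d z d-large N<z+z = *-cancelˡ-< 4 N (d + z) (≤-trans (m≤m+n _ (N + 2))
  (subst₂ _≤_ (lhs N) (rhs d z) (+-mono-≤ d-large (*-monoʳ-≤ 2 N<z+z))))
  where
  lhs : ∀ N → suc (3 * N) + 2 * suc N ≡ suc (4 * N) + (N + 2)
  lhs = solve-∀
  rhs : ∀ d z → 4 * d + 2 * (z + z) ≡ 4 * (d + z)
  rhs = solve-∀

quarters-small : ∀ N x y → 4 * x < N → 4 * y < N → (x + y) + (y + x) < N
quarters-small N x y x-small y-small = *-cancelˡ-≤ 4
  (subst₂ _≤_ (lhs x y) (rhs N) (+-mono-≤ (*-monoʳ-≤ 2 x-small) (*-monoʳ-≤ 2 y-small)))
  where
  lhs : ∀ x y → 2 * suc (4 * x) + 2 * suc (4 * y) ≡ 4 * suc ((x + y) + (y + x))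
  lhs = solve-∀
  rhs : ∀ N → 2 * N + 2 * N ≡ 4 * N
  rhs = solve-∀

-- Large blue components and blue covers

Dense : ColouredBip N → Set
Dense {N} G = (v : Vtx N) → 3 * N < 4 * degree G v

Denseᵀ : {G : ColouredBip N} → Dense G → Dense (G ᵀ)
Denseᵀ dense (inj₁ i) = dense (inj₂ i)
Denseᵀ dense (inj₂ j) = dense (inj₁ j)

N₁ : ColouredBip N → Fin N → Fin N → Bool
N₁ G i j = isEdge (G i j)

N₂ : ColouredBip N → Fin N → Fin N → Bool
N₂ G j i = isEdge (G i j)

isBlue : Maybe Colour → Bool
isBlue e = does (Maybe.≡-dec _≟ᶜ_ e (just blue))

edge-colour : ∀ {e} → isEdge e ≡ true → e ≡ just red ⊎ e ≡ just blue
edge-colour {just red}  _ = inj₁ refl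
edge-colour {just blue} _ = inj₂ refl

red-unless-blue : ∀ {e} → isEdge e ≡ true → e ≢ just blue → e ≡ just red
red-unless-blue e-edge not-blue with edge-colour e-edge
... | inj₁ is-red  = is-red
... | inj₂ is-blue = ⊥-elim (not-blue is-blue)

dense-blue-component : (G : ColouredBip N) → Dense G → (W Z : Fin N → Bool) →
  N < countFin W + countFin W → N < countFin Z + countFin Z →
  (∀ {i j} → W i ≡ true → Z j ≡ true → isEdge (G i j) ≡ true → G i j ≡ just blue) →
  Σ (VSet N) λ D → IsComponent G blue D × W ⊆ D ∘ inj₁ × Z ⊆ D ∘ inj₂
dense-blue-component {N} G dense W Z W-large Z-large W-Z-blue = D , D-component , W⊆D , Z⊆D
  where
  z₀∈Z : ∃ λ z₀ → Z z₀ ≡ true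
  z₀∈Z = countFin-witness (≰⇒> λ Z≤0 → n≮0 (≤-trans Z-large (+-mono-≤ Z≤0 Z≤0)))
  z₀ = proj₁ z₀∈Z
  D-of-z₀ = component-of G blue (inj₂ z₀)
  D = proj₁ D-of-z₀
  D-component = proj₁ (proj₂ D-of-z₀)
  z₀∈D = proj₂ (proj₂ D-of-z₀)
  closed = IsComponent⇒Closed G blue D-component

  common : Fin N → Fin N → Bool
  common z = N₂ G z ∩ N₂ G z₀

  many-common : ∀ z → N < countFin (common z) + countFin (common z)
  many-common z = overlap-large N (degree G (inj₂ z)) (degree G (inj₂ z₀)) _
    (dense (inj₂ z)) (dense (inj₂ z₀)) (countFin-∩ (N₂ G z) (N₂ G z₀))

  -- z and z₀ have more than N/2 common neighbours, so one of them lies in W.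
  Z⊆D : Z ⊆ D ∘ inj₂
  Z⊆D z z∈Z with countFin-∩-nonempty (common z) W (half+half _ (countFin W) (many-common z) W-large)
  ... | i , e with ∩⁻ (common z) W e
  ...   | iz-iz₀ , i∈W with ∩⁻ (N₂ G z) (N₂ G z₀) iz-iz₀
  ...     | iz , iz₀ = closed (closed z₀∈D (rl i z₀ (W-Z-blue i∈W (proj₂ z₀∈Z) iz₀))) (lr i z (W-Z-blue i∈W z∈Z iz))

  W⊆D : W ⊆ D ∘ inj₁
  W⊆D w w∈W with countFin-∩-nonempty (N₁ G w) Z (large+half N (degree G (inj₁ w)) (countFin Z) (dense (inj₁ w)) Z-large)
  ... | j , e with ∩⁻ (N₁ G w) Z e
  ...   | wj , j∈Z = closed (Z⊆D j j∈Z) (rl w j (W-Z-blue w∈W j∈Z wj))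

module BlueCover {N} (G : ColouredBip N) {B S : VSet N}
  (B-component : IsComponent G blue B) (S-min : IsMinBlueCover G B S) where

  B₁ B₂ S₁ S₂ X Y : Fin N → Bool
  B₁ = B ∘ inj₁
  B₂ = B ∘ inj₂
  S₁ = S ∘ inj₁
  S₂ = S ∘ inj₂
  X  = B₁ ─ S₁
  Y  = B₂ ─ S₂

  S⊆B : ∀ v → v ∈ᵛ S → v ∈ᵛ B
  S⊆B = proj₁ (proj₁ S-min)

  S-covers : ∀ i j → G i j ≡ just blue → B₁ i ≡ true → B₂ j ≡ true → S₁ i ≡ true ⊎ S₂ j ≡ true
  S-covers = proj₂ (proj₁ S-min)

  S-minimal : ∀ T → IsBlueCover G B T → size S ≤ size T
  S-minimal = proj₂ S-min

  ∉B⇒∉S : ∀ {v} → B v ≡ false → S v ≡ false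
  ∉B⇒∉S {v} v∉B = Bool.¬-not λ v∈S → case trans (sym (S⊆B v v∈S)) v∉B of λ ()

  X-edge-red : ∀ {x j} → X x ≡ true → S₂ j ≡ false → isEdge (G x j) ≡ true → G x j ≡ just red
  X-edge-red {x} {j} x∈X j∉S edge = red-unless-blue edge λ xj-blue →
    case S-covers x j xj-blue x∈B (IsComponent⇒Closed G blue B-component x∈B (lr x j xj-blue)) of λ where
      (inj₁ x∈S) → case trans (sym x∈S) x∉S of λ ()
      (inj₂ j∈S) → case trans (sym j∈S) j∉S of λ ()
    where
    x∈B = proj₁ (─⁻ B₁ S₁ x∈X)
    x∉S = proj₂ (─⁻ B₁ S₁ x∈X)

  -- B₂ is itself a blue cover of B.
  S₁≤Y : countFin S₁ ≤ countFin Y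
  S₁≤Y = +-cancelʳ-≤ (countFin S₂) _ _ (begin
    countFin S₁ + countFin S₂                 ≤⟨ S-minimal T (T⊆B , λ _ _ _ _ j∈B → inj₂ j∈B) ⟩
    countFin {N} (λ _ → false) + countFin B₂  ≡⟨ cong (_+ countFin B₂) (countFin-none {N} (λ _ → refl)) ⟩
    countFin B₂                               ≡⟨ countFin-⊆ (S⊆B ∘ inj₂) ⟩
    countFin Y + countFin S₂                  ∎)
    where
    open ≤-Reasoning
    T : VSet N
    T (inj₁ _) = false
    T (inj₂ j) = B₂ j
    T⊆B : ∀ v → v ∈ᵛ T → v ∈ᵛ B
    T⊆B (inj₂ j) j∈B = j∈B

  S₂→X : Graph N
  S₂→X j i = X i ∧ isBlue (G i j)

  -- König's argument: trading A for its neighbourhood in X leaves a blue cover,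
  -- so minimality of S bounds |A| by that neighbourhood.
  S₂→X-hall : HallCondition S₂→X S₂
  S₂→X-hall A A⊆S₂ = cancel (countFin S₁ + countFin (S₂ ─ A)) (begin
    countFin S₁ + (countFin (S₂ ─ A) + countFin A)  ≡⟨ cong (countFin S₁ +_) (countFin-⊆ A⊆S₂) ⟨
    countFin S₁ + countFin S₂                       ≤⟨ S-minimal T (T⊆B , T-covers) ⟩
    countFin (S₁ ∪ Nbh S₂→X A) + countFin (S₂ ─ A)  ≤⟨ +-monoˡ-≤ _ (countFin-∪-≤ S₁ (Nbh S₂→X A)) ⟩
    countFin S₁ + countFin (Nbh S₂→X A) + countFin (S₂ ─ A) ∎)
    (lhs (countFin S₁) (countFin (S₂ ─ A)) (countFin A)) (rhs (countFin S₁) (countFin (S₂ ─ A)) (countFin (Nbh S₂→X A)))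
    where
    open ≤-Reasoning
    lhs : ∀ s r a → s + (r + a) ≡ s + r + a
    lhs = solve-∀
    rhs : ∀ s r b → s + b + r ≡ s + r + b
    rhs = solve-∀

    T : VSet N
    T (inj₁ i) = (S₁ ∪ Nbh S₂→X A) i
    T (inj₂ j) = (S₂ ─ A) j

    T⊆B : ∀ v → v ∈ᵛ T → v ∈ᵛ B
    T⊆B (inj₁ i) i∈T with ∪⁻ S₁ (Nbh S₂→X A) i∈T
    ... | inj₁ i∈S = S⊆B (inj₁ i) i∈S
    ... | inj₂ i∈N = let j , _ , e = Nbh⁻ S₂→X A i∈N in proj₁ (─⁻ B₁ S₁ (proj₁ (∩⁻ X (λ i → isBlue (G i j)) e)))
    T⊆B (inj₂ j) j∈T = S⊆B (inj₂ j) (proj₁ (─⁻ S₂ A j∈T))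

    T-covers : ∀ i j → G i j ≡ just blue → B₁ i ≡ true → B₂ j ≡ true → T (inj₁ i) ≡ true ⊎ T (inj₂ j) ≡ true
    T-covers i j ij-blue i∈B j∈B with S-covers i j ij-blue i∈B j∈B
    ... | inj₁ i∈S = inj₁ (∪⁺ˡ S₁ (Nbh S₂→X A) i∈S)
    ... | inj₂ j∈S with A j Bool.≟ true | S₁ i Bool.≟ true
    ...   | no j∉A  | _       = inj₂ (─⁺ S₂ A j∈S (Bool.¬-not j∉A))
    ...   | yes _   | yes i∈S = inj₁ (∪⁺ˡ S₁ (Nbh S₂→X A) i∈S)
    ...   | yes j∈A | no i∉S  = inj₁ (∪⁺ʳ S₁ (Nbh S₂→X A) (Nbh⁺ S₂→X A j∈A
            (∩⁺ X (λ i → isBlue (G i j)) (─⁺ B₁ S₁ i∈B (Bool.¬-not i∉S)) (dec-true (Maybe.≡-dec _≟ᶜ_ (G i j) (just blue)) ij-blue))))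

  S₂-matching : ∀ {n} → n ≤ countFin S₂ → BlueConnMatching G n
  S₂-matching {n} n≤S₂ = edge , match∘g-injective , g-injective , edge-blue , B , B-component ,
                         λ t → proj₁ (─⁻ B₁ S₁ (match-X t))
    where
    open Saturating (hall S₂→X S₂ S₂→X-hall)
    chosen = choose S₂ n n≤S₂
    g = proj₁ chosen
    g∈S₂ = proj₁ (proj₂ chosen)
    g-injective = proj₂ (proj₂ chosen)
    edge : Fin n → Fin N × Fin N
    edge t = match (g t) , g t
    match-X : ∀ t → X (match (g t)) ≡ true
    match-X t = proj₁ (∩⁻ X (λ i → isBlue (G i (g t))) (match-edge (g t) (g∈S₂ t)))
    edge-blue : ∀ t → G (match (g t)) (g t) ≡ just blue
    edge-blue t = from-does (Maybe.≡-dec _≟ᶜ_ _ (just blue)) (proj₂ (∩⁻ X (λ i → isBlue (G i (g t))) (match-edge (g t) (g∈S₂ t))))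
    match∘g-injective : ∀ {s t} → match (g s) ≡ match (g t) → s ≡ t
    match∘g-injective = g-injective ∘ match-injective (g∈S₂ _) (g∈S₂ _)

  X-red-connected : ∀ {n} → Dense G → n + n ≤ N → countFin S₂ < n →
    ∀ {x x′} → X x ≡ true → X x′ ≡ true → Conn G red (inj₁ x) (inj₁ x′)
  X-red-connected {n} dense n+n≤N S₂<n {x} {x′} x∈X x′∈X
    with countFin-<⇒witness {q = S₂} {p = N₁ G x ∩ N₁ G x′} (≤-trans S₂<n (<⇒≤ (half-< _ n+n≤N
           (overlap-large N (degree G (inj₁ x)) (degree G (inj₁ x′)) _ (dense (inj₁ x)) (dense (inj₁ x′))
             (countFin-∩ (N₁ G x) (N₁ G x′))))))
  ... | j , common , j∉S with ∩⁻ (N₁ G x) (N₁ G x′) common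
  ...   | xj , x′j = lr x j (X-edge-red x∈X j∉S xj) ◅ rl x′ j (X-edge-red x′∈X j∉S x′j) ◅ ε

module LargestBlueComponent {N n} (G : ColouredBip N) (dense : Dense G) (n+n≤N : n + n ≤ N)
  (no-matching : ¬ BlueConnMatching G n) {B S : VSet N} (B-component : IsComponent G blue B)
  (B-largest : (Q : VSet N) → IsComponent G blue Q → n ≤ size₁ Q → n ≤ size₂ Q → size Q ≤ size B)
  (S-min : IsMinBlueCover G B S) where

  open BlueCover G B-component S-min
  module ᵀ = BlueCover (G ᵀ) (IsComponentᵀ B-component) (IsMinBlueCoverᵀ S-min)

  S₂<n : countFin S₂ < n
  S₂<n = ≰⇒> (no-matching ∘ S₂-matching)

  S₁<n : countFin S₁ < n
  S₁<n = ≰⇒> (no-matching ∘ BlueConnMatchingᵀ ∘ ᵀ.S₂-matching)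

  X-connected : ∀ {x x′} → X x ≡ true → X x′ ≡ true → Conn G red (inj₁ x) (inj₁ x′)
  X-connected = X-red-connected dense n+n≤N S₂<n

  Y-connected : ∀ {y y′} → Y y ≡ true → Y y′ ≡ true → Conn G red (inj₂ y) (inj₂ y′)
  Y-connected y∈Y y′∈Y = Connᵀ (ᵀ.X-red-connected (Denseᵀ dense) n+n≤N S₁<n y∈Y y′∈Y)

  Z : Fin N → Fin N → Bool
  Z x = N₁ G x ─ B₂

  W : Fin N → Fin N → Bool
  W y = N₂ G y ─ B₁

  red-path : ∀ {x y i j} → X x ≡ true → Y y ≡ true → W y i ≡ true → Z x j ≡ true → G i j ≡ just red →
    Conn G red (inj₁ x) (inj₂ y)
  red-path {x} {y} {i} {j} x∈X y∈Y i∈W j∈Z ij-red =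
    lr x j (X-edge-red x∈X (∉B⇒∉S (proj₂ (─⁻ (N₁ G x) B₂ j∈Z))) (proj₁ (─⁻ (N₁ G x) B₂ j∈Z))) ◅
    rl i j ij-red ◅
    lr i y (ᵀ.X-edge-red y∈Y (∉B⇒∉S (proj₂ (─⁻ (N₂ G y) B₁ i∈W))) (proj₁ (─⁻ (N₂ G y) B₁ i∈W))) ◅ ε

  W-Z-not-red-free : ∀ {x y} → X x ≡ true → Y y ≡ true →
    ¬ (∃ λ j → (Y ∩ N₁ G x) j ≡ true) → ¬ (∃ λ i → (X ∩ N₂ G y) i ≡ true) →
    ¬ (∀ {i j} → W y i ≡ true → Z x j ≡ true → G i j ≢ just red)
  W-Z-not-red-free {x} {y} x∈X y∈Y x↛Y y↛X no-red =
    <⇒≱ B<D (B-largest D D-component (n≤ (W y) W⊆D W-large) (n≤ (Z x) Z⊆D Z-large))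
    where
    Y-small : 4 * countFin Y < N
    Y-small = complement-small N _ (countFin Y) (dense (inj₁ x))
      (≮⇒≥ λ N< → x↛Y (countFin-∩-nonempty Y (N₁ G x) N<))
    X-small : 4 * countFin X < N
    X-small = complement-small N _ (countFin X) (dense (inj₂ y))
      (≮⇒≥ λ N< → y↛X (countFin-∩-nonempty X (N₂ G y) N<))

    S₁-small : 4 * countFin S₁ < N
    S₁-small = ≤-trans (s≤s (*-monoʳ-≤ 4 S₁≤Y)) Y-small
    S₂-small : 4 * countFin S₂ < N
    S₂-small = ≤-trans (s≤s (*-monoʳ-≤ 4 ᵀ.S₁≤Y)) X-small

    x-nbrs : N₁ G x ∩ B₂ ⊆ S₂
    x-nbrs j e with S₂ j Bool.≟ true | ∩⁻ (N₁ G x) B₂ e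
    ... | yes j∈S | _        = j∈S
    ... | no  j∉S | xj , j∈B = ⊥-elim (x↛Y (j , ∩⁺ Y (N₁ G x) (─⁺ B₂ S₂ j∈B (Bool.¬-not j∉S)) xj))
    y-nbrs : N₂ G y ∩ B₁ ⊆ S₁
    y-nbrs i e with S₁ i Bool.≟ true | ∩⁻ (N₂ G y) B₁ e
    ... | yes i∈S | _        = i∈S
    ... | no  i∉S | iy , i∈B = ⊥-elim (y↛X (i , ∩⁺ X (N₂ G y) (─⁺ B₁ S₁ i∈B (Bool.¬-not i∉S)) iy))

    Z-large : N < countFin (Z x) + countFin (Z x)
    Z-large = large-minus-small N _ (countFin (Z x)) (countFin S₂) (dense (inj₁ x))
      (≤-trans (≤-reflexive (countFin-split (N₁ G x) B₂)) (+-monoʳ-≤ (countFin (Z x)) (countFin-mono x-nbrs))) S₂-small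
    W-large : N < countFin (W y) + countFin (W y)
    W-large = large-minus-small N _ (countFin (W y)) (countFin S₁) (dense (inj₂ y))
      (≤-trans (≤-reflexive (countFin-split (N₂ G y) B₁)) (+-monoʳ-≤ (countFin (W y)) (countFin-mono y-nbrs))) S₁-small

    W-Z-blue : ∀ {i j} → W y i ≡ true → Z x j ≡ true → isEdge (G i j) ≡ true → G i j ≡ just blue
    W-Z-blue i∈W j∈Z ij with edge-colour ij
    ... | inj₁ ij-red  = ⊥-elim (no-red i∈W j∈Z ij-red)
    ... | inj₂ ij-blue = ij-blue

    D-spanned = dense-blue-component G dense (W y) (Z x) W-large Z-large W-Z-blue
    D = proj₁ D-spanned
    D-component = proj₁ (proj₂ D-spanned)
    W⊆D = proj₁ (proj₂ (proj₂ D-spanned))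
    Z⊆D = proj₂ (proj₂ (proj₂ D-spanned))

    n≤ : ∀ (P : Fin N → Bool) {Dᵢ} → P ⊆ Dᵢ → N < countFin P + countFin P → n ≤ countFin Dᵢ
    n≤ P P⊆D P-large = ≤-trans (<⇒≤ (half-< (countFin P) n+n≤N P-large)) (countFin-mono P⊆D)

    B<D : size B < size D
    B<D = begin-strict
      size B                                                   ≡⟨ cong₂ _+_ (countFin-⊆ (S⊆B ∘ inj₁)) (countFin-⊆ (S⊆B ∘ inj₂)) ⟩
      (countFin X + countFin S₁) + (countFin Y + countFin S₂)  ≤⟨ +-mono-≤ (+-monoʳ-≤ (countFin X) S₁≤Y) (+-monoʳ-≤ (countFin Y) ᵀ.S₁≤Y) ⟩
      (countFin X + countFin Y) + (countFin Y + countFin X)    <⟨ quarters-small N (countFin X) (countFin Y) X-small Y-small ⟩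
      N                                                        <⟨ half+half (countFin (W y)) (countFin (Z x)) W-large Z-large ⟩
      countFin (W y) + countFin (Z x)                          ≤⟨ +-mono-≤ (countFin-mono W⊆D) (countFin-mono Z⊆D) ⟩
      size D                                                   ∎
      where open ≤-Reasoning

  X-Y-connected : ∀ {x y} → X x ≡ true → Y y ≡ true → Conn G red (inj₁ x) (inj₂ y)
  X-Y-connected {x} {y} x∈X y∈Y with any? (λ j → (Y ∩ N₁ G x) j Bool.≟ true)
  ... | yes (j , e) = let j∈Y , xj = ∩⁻ Y (N₁ G x) e in
    lr x j (X-edge-red x∈X (proj₂ (─⁻ B₂ S₂ j∈Y)) xj) ◅ Y-connected j∈Y y∈Y
  ... | no x↛Y with any? (λ i → (X ∩ N₂ G y) i Bool.≟ true)
  ...   | yes (i , e) = let i∈X , iy = ∩⁻ X (N₂ G y) e in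
    X-connected x∈X i∈X ◅◅ lr i y (ᵀ.X-edge-red y∈Y (proj₂ (─⁻ B₁ S₁ i∈X)) iy) ◅ ε
  ...   | no y↛X with any? (λ i → any? (λ j →
                         W y i Bool.≟ true ×-dec Z x j Bool.≟ true ×-dec Maybe.≡-dec _≟ᶜ_ (G i j) (just red)))
  ...     | yes (i , j , i∈W , j∈Z , ij-red) = red-path x∈X y∈Y i∈W j∈Z ij-red
  ...     | no no-red = ⊥-elim (W-Z-not-red-free x∈X y∈Y x↛Y y↛X
                                  λ i∈W j∈Z ij-red → no-red (_ , _ , i∈W , j∈Z , ij-red))

  red-component : n ≤ size₁ B →
    Σ (VSet N) λ R → IsComponent G red R × ((v : Vtx N) → v ∈ᵛ B → S v ≡ false → v ∈ᵛ R)
  red-component n≤B₁ with countFin-<⇒witness {q = S₁} {p = B₁} (≤-trans S₁<n n≤B₁)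
  ... | x₀ , x₀∈B , x₀∉S = R , R-component , B∖S⊆R
    where
    x₀∈X = ─⁺ B₁ S₁ x₀∈B x₀∉S
    R-of-x₀ = component-of G red (inj₁ x₀)
    R = proj₁ R-of-x₀
    R-component = proj₁ (proj₂ R-of-x₀)
    into-R : ∀ {v} → Conn G red (inj₁ x₀) v → v ∈ᵛ R
    into-R = Closed-Conn G red (IsComponent⇒Closed G red R-component) (proj₂ (proj₂ R-of-x₀))
    B∖S⊆R : (v : Vtx N) → v ∈ᵛ B → S v ≡ false → v ∈ᵛ R
    B∖S⊆R (inj₁ i) i∈B i∉S = into-R (X-connected x₀∈X (─⁺ B₁ S₁ i∈B i∉S))
    B∖S⊆R (inj₂ j) j∈B j∉S = into-R (X-Y-connected x₀∈X (─⁺ B₂ S₂ j∈B j∉S))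

lemma3p3 : (m n : ℕ) → 1 ≤ n → n < m →
    (G : ColouredBip (m + n ∸ 1)) →
    ((v : Vtx (m + n ∸ 1)) → 3 * (m + n ∸ 1) < 4 * degree G v) →
    ¬ BlueConnMatching G n →
    (B : VSet (m + n ∸ 1)) → IsComponent G blue B →
    n ≤ size₁ B → n ≤ size₂ B →
    ((Q : VSet (m + n ∸ 1)) → IsComponent G blue Q → n ≤ size₁ Q → n ≤ size₂ Q →
       size Q ≤ size B) →
    (S : VSet (m + n ∸ 1)) → IsMinBlueCover G B S →
    Σ (VSet (m + n ∸ 1)) λ R → IsComponent G red R ×
      ((v : Vtx (m + n ∸ 1)) → v ∈ᵛ B → S v ≡ false → v ∈ᵛ R)
lemma3p3 m n _ n<m G dense no-matching B B-component n≤B₁ _ B-largest S S-min =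
  LargestBlueComponent.red-component G dense (n+n≤m+n∸1 n<m) no-matching B-component B-largest S-min n≤B₁
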